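{- Let $G$ be a graph with at least one edge and let $x$ be a vertex of $G$ that is not isolated. Then there exists a Z-Grundy dominating sequence of $G$ that contains $x$.
   Context: For a vertex $v$, $N(v)$ is its open neighborhood and $N[v]=N(v)\cup\{v\}$. A Z-sequence of $G$ is a sequence $(v_1,\ldots,v_k)$ of distinct vertices such that for each $i\in[k]$, $N(v_i)\setminus\bigcup_{j=1}^{i-1}N[v_j]\neq\emptyset$. A Z-Grundy dominating sequence is a Z-sequence of maximum length. -}

module Defs where

open import Data.Nat using (ℕ; _≤_)
open import Data.Fin using (Fin)
open import Data.List using (List; []; _∷_; _++_; [_]; length)
open import Data.List.Relation.Unary.All using (All)
open import Data.List.Relation.Unary.Unique.Propositional using (Unique)
open import Data.List.Membership.Propositional using (_∈_)
open import Data.Product using (Σ; _×_; ∃)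
open import Data.Unit using (⊤)
open import Relation.Nullary using (¬_; Dec)
open import Relation.Binary.PropositionalEquality using (_≡_; _≢_)

record Graph (n : ℕ) : Set₁ where
  field
    Adj     : Fin n → Fin n → Set
    sym     : ∀ {u v} → Adj u v → Adj v u
    irrefl  : ∀ {u} → ¬ Adj u u
    adj?    : ∀ u v → Dec (Adj u v)
open Graph public

module _ {n : ℕ} (G : Graph n) where

  NotInClosedNbhd : Fin n → Fin n → Set
  NotInClosedNbhd w u = (u ≢ w) × ¬ Adj G w u

  Footprinted : List (Fin n) → Fin n → Set
  Footprinted prev v = ∃ λ u → Adj G v u × All (λ w → NotInClosedNbhd w u) prev

  ZSeqFrom : List (Fin n) → List (Fin n) → Set
  ZSeqFrom prev []       = ⊤
  ZSeqFrom prev (v ∷ vs) = Footprinted prev v × ZSeqFrom (prev ++ [ v ]) vs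

  IsZSequence : List (Fin n) → Set
  IsZSequence s = Unique s × ZSeqFrom [] s

  IsZGrundyDominating : List (Fin n) → Set
  IsZGrundyDominating s =
    IsZSequence s × (∀ t → IsZSequence t → length t ≤ length s)

  HasEdge : Set
  HasEdge = ∃ λ u → ∃ λ v → Adj G u v

  NotIsolated : Fin n → Set
  NotIsolated x = ∃ λ y → Adj G x y

{-# OPTIONS --safe #-}
module Submission where

-- A Z-sequence (v₁, …, vₖ) is the same thing as a list of pairs (vᵢ, uᵢ) with
-- uᵢ ∈ N(vᵢ) and uᵢ ∉ N[vⱼ] for j < i.  The latter condition is symmetric in
-- the two coordinates, so reversing the list and swapping every pair yields a
-- Z-sequence (uₖ, …, u₁) of the same length.  Fix a longest Z-sequence with
-- such witnesses.  If x is some uᵢ, its reversal contains x.  Otherwise let i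
-- be the last index with x ∈ N[uᵢ]; then x ∈ N(uᵢ) and replacing vᵢ by x keeps
-- every condition.  If there is no such i, then (x, y) for a neighbour y of x
-- can be put in front, contradicting maximality.

open import Defs
open import Data.Nat using (ℕ; zero; suc; _≤_; s≤s)
open import Data.Nat.Properties using (≤-reflexive; ≮⇒≥; n≮n; module ≤-Reasoning)
open import Data.Fin using (Fin; zero; suc) renaming (_<_ to _<ᶠ_)
open import Data.Fin.Properties using (_≟_; any?; pigeonhole)
open import Data.List using (List; []; _∷_; _++_; [_]; length; map; concatMap; filter; reverse; lookup; allFin)
open import Data.List.Properties using (length-map; length-++; length-reverse; unfold-reverse)
open import Data.List.Extrema.Nat using (argmax; argmax-all; f[xs]≤f[argmax])
open import Data.List.Relation.Unary.All as All using (All; []; _∷_; all?)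
import Data.List.Relation.Unary.All.Properties as AllP
open import Data.List.Relation.Unary.AllPairs as AllPairs using (AllPairs; []; _∷_; allPairs?)
import Data.List.Relation.Unary.AllPairs.Properties as AllPairsP
open import Data.List.Relation.Unary.Any as Any using (here; there)
import Data.List.Relation.Unary.Any.Properties as AnyP
open import Data.List.Relation.Unary.Unique.Propositional using (Unique)
open import Data.List.Membership.Propositional using (_∈_)
open import Data.List.Membership.Propositional.Properties
  using (∈-map⁺; ∈-++⁺ʳ; ∈-concatMap⁺; ∈-lookup; ∈-filter⁺; ∈-allFin)
open import Data.Product using (Σ; _×_; _,_; proj₁; proj₂; swap; ∃; ∃-syntax; uncurry; uncurry′)
open import Data.Sum using (_⊎_; inj₁; inj₂)
open import Data.Unit using (tt)
open import Data.Empty using (⊥-elim)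
open import Function using (id; flip; _∘_)
open import Level using (Level)
open import Relation.Nullary using (¬_; Dec; yes; no)
open import Relation.Nullary.Decidable using (_×-dec_; ¬?; decidable-stable)
open import Relation.Unary using (Pred; Decidable)
open import Relation.Binary using (Rel)
open import Relation.Binary.PropositionalEquality as ≡ using (_≡_; _≢_; refl)

private
  variable
    a p ℓ : Level
    A : Set a

module _ {R : Rel A ℓ} where

  AllPairs-lookup : ∀ {xs} → AllPairs R xs → ∀ {i j} → i <ᶠ j → R (lookup xs i) (lookup xs j)
  AllPairs-lookup (rx ∷ _)   {zero}  {suc j} _         = All.lookup rx (∈-lookup j)
  AllPairs-lookup (_  ∷ rxs) {suc i} {suc j} (s≤s i<j) = AllPairs-lookup rxs i<j

  AllPairs-++⁻ : ∀ xs {ys} → AllPairs R (xs ++ ys) →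
                 AllPairs R xs × AllPairs R ys × All (λ x → All (R x) ys) xs
  AllPairs-++⁻ []       rys          = [] , rys , []
  AllPairs-++⁻ (x ∷ xs) (rx ∷ rxsys) with rxs , rys , rxys ← AllPairs-++⁻ xs rxsys =
    AllP.++⁻ˡ xs rx ∷ rxs , rys , AllP.++⁻ʳ xs rx ∷ rxys

  AllPairs-replace : ∀ xs {y y′ zs} → (∀ {x} → R x y → R x y′) → All (R y′) zs →
                     AllPairs R (xs ++ y ∷ zs) → AllPairs R (xs ++ y′ ∷ zs)
  AllPairs-replace xs f ry′ rxyzs with rxs , _ ∷ rzs , rxs-yzs ← AllPairs-++⁻ xs rxyzs =
    AllPairsP.++⁺ rxs (ry′ ∷ rzs) (All.map (λ { (rxy ∷ rxzs) → f rxy ∷ rxzs }) rxs-yzs)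

All-replace : ∀ {P : Pred A p} xs {y y′ zs} → P y′ → All P (xs ++ y ∷ zs) → All P (xs ++ y′ ∷ zs)
All-replace xs py′ pxyzs with pxs , _ ∷ pzs ← AllP.++⁻ xs pxyzs = AllP.++⁺ pxs (py′ ∷ pzs)

All-reverse⁺ : ∀ {P : Pred A p} {xs} → All P xs → All P (reverse xs)
All-reverse⁺ pxs = All.tabulate (All.lookup pxs ∘ AnyP.reverse⁻)

AllPairs-reverse⁺ : ∀ {R : Rel A ℓ} {xs} → AllPairs R xs → AllPairs (flip R) (reverse xs)
AllPairs-reverse⁺ {xs = []}     []         = []
AllPairs-reverse⁺ {xs = x ∷ xs} (rx ∷ rxs) rewrite unfold-reverse x xs =
  AllPairsP.++⁺ (AllPairs-reverse⁺ rxs) ([] ∷ []) (All.map (_∷ []) (All-reverse⁺ rx))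

module _ {P : Pred A p} (P? : Decidable P) where

  all⊎lastViolation : ∀ xs → All P xs ⊎ ∃[ ys ] ∃[ z ] ∃[ zs ] xs ≡ ys ++ z ∷ zs × ¬ P z × All P zs
  all⊎lastViolation []       = inj₁ []
  all⊎lastViolation (x ∷ xs) with all⊎lastViolation xs
  ... | inj₂ (ys , z , zs , refl , ¬pz , pzs) = inj₂ (x ∷ ys , z , zs , refl , ¬pz , pzs)
  ... | inj₁ pxs with P? x
  ...   | yes px  = inj₁ (px ∷ pxs)
  ...   | no  ¬px = inj₂ ([] , x , xs , refl , ¬px , pxs)

listsUpTo : List A → ℕ → List (List A)
listsUpTo xs zero    = [ [] ]
listsUpTo xs (suc k) = [] ∷ concatMap (λ x → map (x ∷_) (listsUpTo xs k)) xs

∈-listsUpTo : ∀ {xs : List A} k {t} → All (_∈ xs) t → length t ≤ k → t ∈ listsUpTo xs k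
∈-listsUpTo zero    []          _         = here refl
∈-listsUpTo (suc k) []          _         = here refl
∈-listsUpTo (suc k) (x∈xs ∷ t⊆) (s≤s t≤k) =
  there (∈-concatMap⁺ (λ x → map (x ∷_) (listsUpTo _ k)) (Any.map (λ { refl → ∈-map⁺ (_ ∷_) (∈-listsUpTo k t⊆ t≤k) }) x∈xs))

longest : ∀ {P : Pred (List A) p} → Decidable P → (L : List (List A)) → (∀ {t} → P t → t ∈ L) →
          P [] → ∃[ s ] P s × (∀ t → P t → length t ≤ length s)
longest P? L complete p[] =
  argmax length [] candidates ,
  argmax-all length p[] (AllP.all-filter P? L) ,
  λ t pt → All.lookup (f[xs]≤f[argmax] [] candidates) (∈-filter⁺ P? (complete pt) pt)
  where candidates = filter P? L

Unique-length≤ : ∀ {n} {t : List (Fin n)} → Unique t → length t ≤ n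
Unique-length≤ {t = t} t! = ≮⇒≥ λ n<|t| →
  let i , j , i<j , tᵢ≡tⱼ = pigeonhole n<|t| (lookup t) in AllPairs-lookup t! i<j tᵢ≡tⱼ

module _ {n : ℕ} (G : Graph n) where

  notInClosedNbhd? : ∀ w u → Dec (NotInClosedNbhd G w u)
  notInClosedNbhd? w u = ¬? (u ≟ w) ×-dec ¬? (adj? G w u)

  notInClosedNbhd-sym : ∀ {w u} → NotInClosedNbhd G w u → NotInClosedNbhd G u w
  notInClosedNbhd-sym (u≢w , w≁u) = u≢w ∘ ≡.sym , w≁u ∘ sym G

  zSeqFrom? : ∀ prev s → Dec (ZSeqFrom G prev s)
  zSeqFrom? prev []       = yes tt
  zSeqFrom? prev (v ∷ vs) =
    any? (λ u → adj? G v u ×-dec all? (λ w → notInClosedNbhd? w u) prev)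
    ×-dec zSeqFrom? (prev ++ [ v ]) vs

  isZSequence? : ∀ s → Dec (IsZSequence G s)
  isZSequence? s = allPairs? (λ u v → ¬? (u ≟ v)) s ×-dec zSeqFrom? [] s

  zGrundyDominating-exists : ∃ (IsZGrundyDominating G)
  zGrundyDominating-exists = longest isZSequence? (listsUpTo (allFin n) n) complete ([] , tt)
    where
    complete : ∀ {t} → IsZSequence G t → t ∈ listsUpTo (allFin n) n
    complete (t! , _) = ∈-listsUpTo n (All.universal ∈-allFin _) (Unique-length≤ t!)

  Edge : Pred (Fin n × Fin n) _
  Edge p = Adj G (proj₁ p) (proj₂ p)

  Precedes : Rel (Fin n × Fin n) _
  Precedes p q = NotInClosedNbhd G (proj₁ p) (proj₂ q)

  IsFootprintSeq : List (Fin n × Fin n) → Set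
  IsFootprintSeq ps = All Edge ps × AllPairs Precedes ps

  private
    PrivateTo : List (Fin n) → Pred (Fin n × Fin n) _
    PrivateTo prev q = All (λ w → NotInClosedNbhd G w (proj₂ q)) prev

    zSeqFrom⇒footprints : ∀ prev s → ZSeqFrom G prev s →
      ∃[ ps ] map proj₁ ps ≡ s × IsFootprintSeq ps × All (PrivateTo prev) ps
    zSeqFrom⇒footprints prev []       _ = [] , refl , ([] , []) , []
    zSeqFrom⇒footprints prev (v ∷ vs) ((u , v~u , u-private) , z)
      with ps , refl , (edges , precs) , privs ← zSeqFrom⇒footprints (prev ++ [ v ]) vs z
      with privs′ , vps ← All.unzip (All.map AllP.∷ʳ⁻ privs) =
      (v , u) ∷ ps , refl , (v~u ∷ edges , vps ∷ precs) , u-private ∷ privs′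

    footprints⇒zSeqFrom : ∀ prev ps → IsFootprintSeq ps → All (PrivateTo prev) ps →
                          ZSeqFrom G prev (map proj₁ ps)
    footprints⇒zSeqFrom prev []            _                          _              = tt
    footprints⇒zSeqFrom prev ((v , u) ∷ ps) (v~u ∷ edges , vps ∷ precs) (priv ∷ privs) =
      (u , v~u , priv) ,
      footprints⇒zSeqFrom (prev ++ [ v ]) ps (edges , precs) (All.zipWith (uncurry AllP.∷ʳ⁺) (privs , vps))

    precedes⇒distinct : ∀ {p q} → Precedes p q → Edge q → proj₁ p ≢ proj₁ q
    precedes⇒distinct (_ , p₁≁q₂) q₁~q₂ refl = p₁≁q₂ q₁~q₂

    footprints⇒unique : ∀ {ps} → IsFootprintSeq ps → Unique (map proj₁ ps)
    footprints⇒unique         ([]        , [])          = []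
    footprints⇒unique {p ∷ _} (_ ∷ edges , vps ∷ precs) =
      AllP.map⁺ (All.zipWith (λ {q} → uncurry′ (precedes⇒distinct {p} {q})) (vps , edges)) ∷ footprints⇒unique (edges , precs)

  zSequence⇒footprints : ∀ {s} → IsZSequence G s → ∃[ ps ] map proj₁ ps ≡ s × IsFootprintSeq ps
  zSequence⇒footprints (_ , z) with ps , eq , fps , _ ← zSeqFrom⇒footprints [] _ z = ps , eq , fps

  footprints⇒zSequence : ∀ {ps} → IsFootprintSeq ps → IsZSequence G (map proj₁ ps)
  footprints⇒zSequence fps = footprints⇒unique fps , footprints⇒zSeqFrom [] _ fps (All.universal (λ _ → []) _)

  footprints-reverse : ∀ {ps} → IsFootprintSeq ps → IsFootprintSeq (reverse (map swap ps))
  footprints-reverse (edges , precs) =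
    All-reverse⁺ (AllP.map⁺ (All.map (sym G) edges)) ,
    AllPairs-reverse⁺ (AllPairsP.map⁺ (AllPairs.map notInClosedNbhd-sym precs))

  footprints-replace : ∀ qs {v u x rs} → Adj G x u → All (λ q → NotInClosedNbhd G x (proj₂ q)) rs →
                       IsFootprintSeq (qs ++ (v , u) ∷ rs) → IsFootprintSeq (qs ++ (x , u) ∷ rs)
  footprints-replace qs x~u x-outside (edges , precs) =
    All-replace qs x~u edges , AllPairs-replace qs id x-outside precs

  footprints-longer⇒zGrundy : ∀ {ps qs : List (Fin n × Fin n)} → IsZGrundyDominating G (map proj₁ ps) → IsFootprintSeq qs →
                              length ps ≤ length qs → IsZGrundyDominating G (map proj₁ qs)
  footprints-longer⇒zGrundy {ps} {qs} (_ , maximal) fqs |ps|≤|qs| = footprints⇒zSequence fqs , bound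
    where
    open ≤-Reasoning
    bound : ∀ t → IsZSequence G t → length t ≤ length (map proj₁ qs)
    bound t zt = begin
      length t              ≤⟨ maximal t zt ⟩
      length (map proj₁ ps) ≡⟨ length-map proj₁ ps ⟩
      length ps             ≤⟨ |ps|≤|qs| ⟩
      length qs             ≡⟨ length-map proj₁ qs ⟨
      length (map proj₁ qs) ∎

-- The hypothesis HasEdge G is implied by NotIsolated G x.
proposition3p1 : (n : ℕ) (G : Graph n) → HasEdge G → (x : Fin n) → NotIsolated G x →
    Σ (List (Fin n)) (λ s → IsZGrundyDominating G s × x ∈ s)
proposition3p1 n G _ x (y , x~y)
  with s , s-grundy@(zs , maximal) ← zGrundyDominating-exists G
  with ps , refl , fps@(edges , precs) ← zSequence⇒footprints G zs
  with all⊎lastViolation (λ q → notInClosedNbhd? G x (proj₂ q)) ps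
... | inj₁ x-outside =
  ⊥-elim (n≮n _ (maximal _ (footprints⇒zSequence G (x~y ∷ edges , x-outside ∷ precs))))
... | inj₂ (qs , (v , u) , rs , refl , x∈N[u] , x-outside) with u ≟ x
...   | yes refl =
  map proj₁ (reverse (map swap ps)) ,
  footprints-longer⇒zGrundy G s-grundy (footprints-reverse G fps)
    (≤-reflexive (≡.sym (≡.trans (length-reverse (map swap ps)) (length-map swap ps)))) ,
  ∈-map⁺ proj₁ (AnyP.reverse⁺ (∈-map⁺ swap (∈-++⁺ʳ qs (here refl))))
...   | no u≢x =
  map proj₁ (qs ++ (x , u) ∷ rs) ,
  footprints-longer⇒zGrundy G s-grundy (footprints-replace G qs x~u x-outside fps)
    (≤-reflexive (≡.trans (length-++ qs) (≡.sym (length-++ qs)))) ,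
  ∈-map⁺ proj₁ (∈-++⁺ʳ qs (here refl))
  where
  x~u : Adj G x u
  x~u = decidable-stable (adj? G x u) (λ x≁u → x∈N[u] (u≢x , x≁u))
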